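{- Let $(p\colon\mathbb{E}\to\mathbb{B},O,\Omega)$ and $(q\colon\mathbb{F}\to\mathbb{C},O',\Pi)$ be $\mathbf{CLat}_\sqcap$-fibrations with truth values indexed by $A=1$, $F\colon\mathbb{B}\to\mathbb{C}$, $\tau\colon F(O)\to O'$. Let $\dot F\colon\mathbb{E}\to\mathbb{F}$ be a lifting of $F$ along $p,q$ that is fibered (i.e. $(Ff)^*(\dot FP)=\dot F(f^*P)$ for all $f,P$) and preserves fibered meets. Assume $\bigwedge_{k\in\mathbb{E}(P,\Omega)}(pk)^*\Omega=P$ for all $P\in\mathbb{E}$ (i.e. $R^{\Omega}_p\circ L^{\Omega}_p=\mathrm{id}$). Then: (1) $\dot F(P)=\bigwedge_{k\in\mathbb{E}(P,\Omega)}(F(pk))^*(\dot F\Omega)$ for all $P\in\mathbb{E}$; (2) $F^{\Omega,\Pi}_{\tau}=\dot F$ if and only if $F^{\Omega,\Pi}_{\tau}(\Omega)=\dot F(\Omega)$.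
   Context: $\mathbf{CLat}_\sqcap$-fibrations are posetal fibrations with complete-lattice fibers (order $\sqsubseteq$, meet $\bigwedge$) and meet-preserving reindexing; truth values are $\Omega\in\mathbb{E}$ over $O$ and $\Pi\in\mathbb{F}$ over $O'$. A lifting means $q\circ\dot F=F\circ p$. The codensity lifting is $F^{\Omega,\Pi}_{\tau}(P)=\bigwedge_{k\in\mathbb{E}(P,\Omega)}(\tau\circ F(pk))^*\Pi$. -}

module Defs where

open import Level using (Level; _⊔_) renaming (suc to lsuc)
open import Data.Product using (Σ; proj₁; proj₂; _,_)
open import Relation.Binary.PropositionalEquality using (_≡_)

record Category (o ℓ : Level) : Set (lsuc (o ⊔ ℓ)) where
  infixr 9 _∘_
  field
    Obj : Set o
    Hom : Obj → Obj → Set ℓ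
    id  : ∀ {A} → Hom A A
    _∘_ : ∀ {A B C} → Hom B C → Hom A B → Hom A C
    identityˡ : ∀ {A B} (f : Hom A B) → id ∘ f ≡ f
    identityʳ : ∀ {A B} (f : Hom A B) → f ∘ id ≡ f
    assoc : ∀ {A B C D} (h : Hom C D) (g : Hom B C) (f : Hom A B) →
            (h ∘ g) ∘ f ≡ h ∘ (g ∘ f)

record Functor {o ℓ o' ℓ' : Level} (C : Category o ℓ) (D : Category o' ℓ')
       : Set (o ⊔ ℓ ⊔ o' ⊔ ℓ') where
  private
    module C = Category C
    module D = Category D
  field
    F₀ : C.Obj → D.Obj
    F₁ : ∀ {A B} → C.Hom A B → D.Hom (F₀ A) (F₀ B)
    F-id : ∀ {A} → F₁ (C.id {A}) ≡ D.id
    F-∘  : ∀ {A B E} (g : C.Hom B E) (f : C.Hom A B) →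
           F₁ (g C.∘ f) ≡ F₁ g D.∘ F₁ f

record CompleteLattice (ℓ : Level) : Set (lsuc ℓ) where
  infix 4 _⊑_
  field
    Carrier : Set ℓ
    _⊑_ : Carrier → Carrier → Set ℓ
    ⊑-refl : ∀ {x} → x ⊑ x
    ⊑-trans : ∀ {x y z} → x ⊑ y → y ⊑ z → x ⊑ z
    ⊑-antisym : ∀ {x y} → x ⊑ y → y ⊑ x → x ≡ y
    ⋀ : {I : Set ℓ} → (I → Carrier) → Carrier
    ⋀-lb : {I : Set ℓ} (P : I → Carrier) (i : I) → ⋀ P ⊑ P i
    ⋀-glb : {I : Set ℓ} (P : I → Carrier) (x : Carrier) →
            (∀ i → x ⊑ P i) → x ⊑ ⋀ P

-- A CLat_⊓-fibration over B, presented (as every posetal fibration can be,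
-- uniquely up to iso) by its fibres and its reindexing maps f^*.
record CLatFibration {o ℓ : Level} (B : Category o ℓ) : Set (o ⊔ lsuc ℓ) where
  open Category B
  field
    Fib : Obj → CompleteLattice ℓ
  El : Obj → Set ℓ
  El X = CompleteLattice.Carrier (Fib X)
  _⊑[_]_ : ∀ {X} → El X → (Y : Obj) → El X → Set ℓ
  _⊑[_]_ {X} x _ y = CompleteLattice._⊑_ (Fib X) x y
  ⋀[_] : (X : Obj) {I : Set ℓ} → (I → El X) → El X
  ⋀[ X ] P = CompleteLattice.⋀ (Fib X) P
  field
    reindex : ∀ {X Y} → Hom X Y → El Y → El X
    reindex-id : ∀ {X} (P : El X) → reindex (id {X}) P ≡ P
    reindex-∘ : ∀ {X Y Z} (g : Hom Y Z) (f : Hom X Y) (P : El Z) →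
                reindex (g ∘ f) P ≡ reindex f (reindex g P)
    reindex-⋀ : ∀ {X Y} (f : Hom X Y) {I : Set ℓ} (P : I → El Y) →
                reindex f (⋀[ Y ] P) ≡ ⋀[ X ] (λ i → reindex f (P i))

module _ {o ℓ o' : Level} {B : Category o ℓ} {C : Category o' ℓ}
         (p : CLatFibration B) (q : CLatFibration C) (F : Functor B C) where
  private
    module B = Category B
    module C = Category C
    module p = CLatFibration p
    module q = CLatFibration q
    open Functor F

  -- Since the fibrations are
  -- posetal, Ḟ is determined by its action on objects, and functoriality
  -- amounts to: a morphism (X,P) → (Y,Q) over f yields one (FX,ḞP) → (FY,ḞQ)
  -- over Ff.
  record Lifting : Set (o ⊔ ℓ) where
    field
      Ḟ : ∀ {X} → p.El X → q.El (F₀ X)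
      Ḟ-mor : ∀ {X Y} (f : B.Hom X Y) (P : p.El X) (Q : p.El Y) →
              P p.⊑[ X ] p.reindex f Q →
              Ḟ P q.⊑[ F₀ X ] q.reindex (F₁ f) (Ḟ Q)

  Fibered : Lifting → Set (o ⊔ ℓ)
  Fibered L = ∀ {X Y} (f : B.Hom X Y) (Q : p.El Y) →
              q.reindex (F₁ f) (Ḟ Q) ≡ Ḟ (p.reindex f Q)
    where open Lifting L

  PreservesMeets : Lifting → Set (o ⊔ lsuc ℓ)
  PreservesMeets L = ∀ {X} {I : Set ℓ} (P : I → p.El X) →
                     Ḟ (p.⋀[ X ] P) ≡ q.⋀[ F₀ X ] (λ i → Ḟ (P i))
    where open Lifting L

  -- E(P, Ω): morphisms (X,P) → (O,Ω) in the total category of p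
  Arr : ∀ {X} (P : p.El X) (O : B.Obj) (Ω : p.El O) → Set ℓ
  Arr {X} P O Ω = Σ (B.Hom X O) (λ f → P p.⊑[ X ] p.reindex f Ω)

  codensity : (O : B.Obj) (Ω : p.El O) (O' : C.Obj) (Π : q.El O')
              (τ : C.Hom (F₀ O) O') → ∀ {X} → p.El X → q.El (F₀ X)
  codensity O Ω O' Π τ {X} P =
    q.⋀[ F₀ X ] {Arr P O Ω} (λ k → q.reindex (τ C.∘ F₁ (proj₁ k)) Π)

{-# OPTIONS --safe #-}

-- Since every P is the meet of the reindexings (pk)^*Ω, a fibered,
-- meet-preserving Ḟ is determined by ḞΩ through Ḟ P = ⋀_k (F pk)^*(ḞΩ).
-- The codensity lifting obeys the same formula with no hypotheses at all:
-- being a lifting gives one inequality and F^{Ω,Π}_τ(Ω) ⊑ τ^*Π the other.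
-- Hence the two liftings agree everywhere as soon as they agree at Ω.
module Submission where

open import Defs
open import Level using (Level; Lift; lift)
open import Data.Bool using (Bool; true; false)
open import Data.Product using (proj₁; _×_; _,_)
open import Relation.Binary.PropositionalEquality
  using (_≡_; refl; sym; trans; cong; module ≡-Reasoning)

module CLatFibrationProperties {o ℓ : Level} {B : Category o ℓ}
                               (r : CLatFibration B) where
  open Category B
  open CLatFibration r

  module _ {X : Obj} where
    open CompleteLattice (Fib X) public
      using (⊑-refl; ⊑-trans; ⊑-antisym; ⋀-lb; ⋀-glb)

  ≡⇒⊑ : ∀ {X} {x y : El X} → x ≡ y → x ⊑[ X ] y
  ≡⇒⊑ refl = ⊑-refl

  ⋀-cong : ∀ {X} {I : Set ℓ} {P Q : I → El X} →
           (∀ i → P i ≡ Q i) → ⋀[ X ] P ≡ ⋀[ X ] Q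
  ⋀-cong P≡Q = ⊑-antisym
    (⋀-glb _ _ λ i → ⊑-trans (⋀-lb _ i) (≡⇒⊑ (P≡Q i)))
    (⋀-glb _ _ λ i → ⊑-trans (⋀-lb _ i) (≡⇒⊑ (sym (P≡Q i))))

  -- x ⊑ y makes x the meet of the pair {x, y}, and f^* preserves that meet.
  reindex-mono : ∀ {X Y} (f : Hom X Y) {x y : El Y} →
                 x ⊑[ Y ] y → reindex f x ⊑[ X ] reindex f y
  reindex-mono {Y = Y} f {x} {y} x⊑y =
    ⊑-trans (≡⇒⊑ (cong (reindex f) (sym ⋀pair≡x)))
      (⊑-trans (≡⇒⊑ (reindex-⋀ f pair)) (⋀-lb _ (lift false)))
    where
    pair : Lift _ Bool → El Y
    pair (lift true)  = x
    pair (lift false) = y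

    ⋀pair≡x : ⋀[ Y ] pair ≡ x
    ⋀pair≡x = ⊑-antisym (⋀-lb pair (lift true))
      (⋀-glb pair x λ { (lift true) → ⊑-refl ; (lift false) → x⊑y })

module Extension {o o' ℓ : Level} {B : Category o ℓ} {C : Category o' ℓ}
                 (p : CLatFibration B) (q : CLatFibration C) (F : Functor B C)
                 (O : Category.Obj B) (Ω : CLatFibration.El p O) where
  private
    module B = Category B
    module C = Category C
    module p where
      open CLatFibration p public
      open CLatFibrationProperties p public
    module q where
      open CLatFibration q public
      open CLatFibrationProperties q public
  open Functor F
  open ≡-Reasoning

  -- The codensity lifting for τ = id and Π = R, up to id ∘ F(pk) = F(pk).
  extend : q.El (F₀ O) → ∀ {X} → p.El X → q.El (F₀ X)
  extend R {X} P =
    q.⋀[ F₀ X ] {Arr p q F P O Ω} (λ k → q.reindex (F₁ (proj₁ k)) R)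

  Arr-id : Arr p q F Ω O Ω
  Arr-id = B.id , p.≡⇒⊑ (sym (p.reindex-id Ω))

  Arr-precompose : ∀ {X Y} {P : p.El X} {Q : p.El Y} (f : B.Hom X Y) →
                   P p.⊑[ X ] p.reindex f Q →
                   Arr p q F Q O Ω → Arr p q F P O Ω
  Arr-precompose f P⊑f*Q (g , Q⊑g*Ω) =
    g B.∘ f ,
    p.⊑-trans P⊑f*Q
      (p.⊑-trans (p.reindex-mono f Q⊑g*Ω) (p.≡⇒⊑ (sym (p.reindex-∘ g f Ω))))

  lifting-⊑-extend : (L : Lifting p q F) → ∀ {X} (P : p.El X) →
                     Lifting.Ḟ L P q.⊑[ F₀ X ] extend (Lifting.Ḟ L Ω) P
  lifting-⊑-extend L P = q.⋀-glb _ _ λ (f , P⊑f*Ω) → Ḟ-mor f P Ω P⊑f*Ω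
    where open Lifting L

  fibered-extends : (L : Lifting p q F) → Fibered p q F L → PreservesMeets p q F L →
                    ∀ {X} (P : p.El X) →
                    p.⋀[ X ] {Arr p q F P O Ω} (λ k → p.reindex (proj₁ k) Ω) ≡ P →
                    Lifting.Ḟ L P ≡ extend (Lifting.Ḟ L Ω) P
  fibered-extends L fibered preserves {X} P P≡⋀ = begin
    Ḟ P
      ≡⟨ cong Ḟ (sym P≡⋀) ⟩
    Ḟ (p.⋀[ X ] (λ k → p.reindex (proj₁ k) Ω))
      ≡⟨ preserves _ ⟩
    q.⋀[ F₀ X ] (λ k → Ḟ (p.reindex (proj₁ k) Ω))
      ≡⟨ q.⋀-cong (λ k → sym (fibered (proj₁ k) Ω)) ⟩
    extend (Ḟ Ω) P ∎
    where open Lifting L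

  module Codensity (O' : C.Obj) (Π : q.El O') (τ : C.Hom (F₀ O) O') where
    private
      cod : ∀ {X} → p.El X → q.El (F₀ X)
      cod = codensity p q F O Ω O' Π τ

    reindex-τ∘F₁ : ∀ {X Y} (f : B.Hom X Y) (g : B.Hom Y O) →
                   q.reindex (F₁ f) (q.reindex (τ C.∘ F₁ g) Π) ≡
                   q.reindex (τ C.∘ F₁ (g B.∘ f)) Π
    reindex-τ∘F₁ f g = begin
      q.reindex (F₁ f) (q.reindex (τ C.∘ F₁ g) Π)
        ≡⟨ sym (q.reindex-∘ _ _ Π) ⟩
      q.reindex ((τ C.∘ F₁ g) C.∘ F₁ f) Π
        ≡⟨ cong (λ h → q.reindex h Π) (C.assoc τ (F₁ g) (F₁ f)) ⟩
      q.reindex (τ C.∘ (F₁ g C.∘ F₁ f)) Π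
        ≡⟨ cong (λ h → q.reindex (τ C.∘ h) Π) (sym (F-∘ g f)) ⟩
      q.reindex (τ C.∘ F₁ (g B.∘ f)) Π ∎

    codensity-mor : ∀ {X Y} (f : B.Hom X Y) (P : p.El X) (Q : p.El Y) →
                    P p.⊑[ X ] p.reindex f Q →
                    cod P q.⊑[ F₀ X ] q.reindex (F₁ f) (cod Q)
    codensity-mor f P Q P⊑f*Q =
      q.⊑-trans
        (q.⋀-glb _ _ λ (g , Q⊑g*Ω) →
          q.⊑-trans (q.⋀-lb _ (Arr-precompose f P⊑f*Q (g , Q⊑g*Ω)))
                    (q.≡⇒⊑ (sym (reindex-τ∘F₁ f g))))
        (q.≡⇒⊑ (sym (q.reindex-⋀ (F₁ f) _)))

    codensityLifting : Lifting p q F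
    codensityLifting = record { Ḟ = cod ; Ḟ-mor = codensity-mor }

    codensity-Ω-⊑ : cod Ω q.⊑[ F₀ O ] q.reindex τ Π
    codensity-Ω-⊑ = q.⊑-trans (q.⋀-lb _ Arr-id) (q.≡⇒⊑ τ∘F₁id≡τ)
      where
      τ∘F₁id≡τ : q.reindex (τ C.∘ F₁ B.id) Π ≡ q.reindex τ Π
      τ∘F₁id≡τ = cong (λ h → q.reindex h Π)
                      (trans (cong (τ C.∘_) F-id) (C.identityʳ τ))

    extend-codensity-⊑ : ∀ {X} (P : p.El X) →
                         extend (cod Ω) P q.⊑[ F₀ X ] cod P
    extend-codensity-⊑ P = q.⋀-glb _ _ λ k →
      q.⊑-trans (q.⋀-lb _ k)
        (q.⊑-trans (q.reindex-mono (F₁ (proj₁ k)) codensity-Ω-⊑)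
                   (q.≡⇒⊑ (sym (q.reindex-∘ τ (F₁ (proj₁ k)) Π))))

    codensity-extends : ∀ {X} (P : p.El X) → cod P ≡ extend (cod Ω) P
    codensity-extends P =
      q.⊑-antisym (lifting-⊑-extend codensityLifting P) (extend-codensity-⊑ P)

proposition2 : ∀ {o o' ℓ : Level} {B : Category o ℓ} {C : Category o' ℓ}
  (p : CLatFibration B) (q : CLatFibration C) (F : Functor B C)
  (O : Category.Obj B) (Ω : CLatFibration.El p O)
  (O' : Category.Obj C) (Π : CLatFibration.El q O')
  (τ : Category.Hom C (Functor.F₀ F O) O')
  (L : Lifting p q F) → Fibered p q F L → PreservesMeets p q F L →
  (∀ {X} (P : CLatFibration.El p X) →
    CLatFibration.⋀[_] p X {Arr p q F P O Ω}
      (λ k → CLatFibration.reindex p (proj₁ k) Ω) ≡ P) →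
  (∀ {X} (P : CLatFibration.El p X) →
    Lifting.Ḟ L P ≡
      CLatFibration.⋀[_] q (Functor.F₀ F X) {Arr p q F P O Ω}
        (λ k → CLatFibration.reindex q (Functor.F₁ F (proj₁ k)) (Lifting.Ḟ L Ω)))
  ×
  (((∀ {X} (P : CLatFibration.El p X) →
      codensity p q F O Ω O' Π τ P ≡ Lifting.Ḟ L P) →
    codensity p q F O Ω O' Π τ Ω ≡ Lifting.Ḟ L Ω)
   ×
   (codensity p q F O Ω O' Π τ Ω ≡ Lifting.Ḟ L Ω →
    ∀ {X} (P : CLatFibration.El p X) →
      codensity p q F O Ω O' Π τ P ≡ Lifting.Ḟ L P))
proposition2 p q F O Ω O' Π τ L fibered preserves Ω-generates =
  Ḟ-extends , (λ agree → agree Ω) , codensity≡Ḟ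
  where
  open Lifting L
  open Extension p q F O Ω
  open Codensity O' Π τ
  open ≡-Reasoning

  Ḟ-extends : ∀ {X} (P : CLatFibration.El p X) → Ḟ P ≡ extend (Ḟ Ω) P
  Ḟ-extends P = fibered-extends L fibered preserves P (Ω-generates P)

  codensity≡Ḟ : codensity p q F O Ω O' Π τ Ω ≡ Ḟ Ω →
                ∀ {X} (P : CLatFibration.El p X) → codensity p q F O Ω O' Π τ P ≡ Ḟ P
  codensity≡Ḟ atΩ P = begin
    codensity p q F O Ω O' Π τ P
      ≡⟨ codensity-extends P ⟩
    extend (codensity p q F O Ω O' Π τ Ω) P
      ≡⟨ cong (λ R → extend R P) atΩ ⟩
    extend (Ḟ Ω) P
      ≡⟨ sym (Ḟ-extends P) ⟩
    Ḟ P ∎
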